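{- There exists $n\ge1$ (for example $n=3$) such that the following holds for the set $\mathcal{P}_n$ of all PC prographs of size $n$. The relation $\le$, in which $P\le Q$ if and only if $Q$ is obtained from $P$ by a finite (possibly empty) sequence of applications of the four oriented rotation rules (R1)–(R4), is a partial order, but the poset $(\mathcal{P}_n,\le)$ is not a lattice.
   Context: A PC prograph of size $n$ is a connected, directed, acyclic graph embedded in the plane with all edges drawn going upward, considered up to isotopy. It has $n$ coproducts and $n$ products: - a coproduct has one input (from below) and two outputs (upward), called left and right according to the planar embedding; - a product has two inputs, left and right according to the embedding, and one output. Every input is connected by an edge to exactly one output, with two exceptions: exactly one coproduct has its input unconnected (the global input), and exactly one product has its output unconnected (the global output). The embedding is planar. The four oriented rotation rules are local rewritings; all edges outside the configuration are unchanged. (R1) A coproduct $c_1$ has its right output feeding a coproduct $c_2$. The outputs, left to right, are $x$ (from $c_1$) and $y,z$ (from $c_2$). Replace by: the left output of $c_1$ feeds $c_2$, $c_2$ has outputs $x,y$, and the right output of $c_1$ is $z$. The input of $c_1$ is unchanged. (R2) A product $p_1$ has its left input fed by a product $p_2$. The inputs, left to right, are $x,y$ (of $p_2$) and $z$ (right input of $p_1$). Replace by: $p_2$ feeds the right input of $p_1$, $p_1$ has left input $x$, and $p_2$ has inputs $y,z$. The output of $p_1$ is unchanged. (R3) The left output of a coproduct $c$ feeds the right input of a product $p$. Here $p$ has left input edge $x$ and output edge $u$; $c$ has input edge $y$ and right output edge $v$. Replace by a product with inputs $x,y$ (left to right) whose output feeds a coproduct with outputs $u,v$ (left to right). (R4)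 The output of a product with inputs $x,y$ feeds the input of a coproduct with outputs $u,v$. Replace by: a coproduct with input $x$, left output $u$, and right output feeding the left input of a product; this product has right input $y$ and output $v$. -}

module Defs where

open import Data.Nat using (ℕ; zero; suc; _+_; _<_; _≤_)
open import Data.List using (List; []; _∷_; _++_)
open import Data.Product using (Σ; _×_; _,_; ∃)
open import Data.Sum using (_⊎_)
open import Relation.Binary.PropositionalEquality using (_≡_)
open import Relation.Binary.Construct.Closure.ReflexiveTransitive using (Star)
open import Relation.Binary.Construct.Closure.Equivalence using (EqClosure)
open import Relation.Binary.Core using (Rel)

-- A diagram is read bottom-to-top as a sequence of layers; every layer
-- contains exactly one vertex acting on a row of parallel strands,
-- numbered 0,1,2,... from left to right.
--   cop i  : a coproduct on strand i   (k strands ↦ k+1 strands),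
--            its left/right outputs become strands i, i+1;
--   prod i : a product on strands i, i+1 (left/right inputs)
--            (k strands ↦ k-1 strands), its output becomes strand i.
-- Isotopy classes of planar upward diagrams are exactly such words
-- modulo the interchange law (sliding vertices past each other in height).

data Gen : Set where
  cop  : ℕ → Gen
  prod : ℕ → Gen

data Typed : ℕ → List Gen → ℕ → Set where
  done  : ∀ {k} → Typed k [] k
  copT  : ∀ {k m i w} → i < k → Typed (suc k) w m → Typed k (cop i ∷ w) m
  prodT : ∀ {k m i w} → suc i < suc k → Typed k w m →
          Typed (suc k) (prod i ∷ w) m

countCop : List Gen → ℕ
countCop []             = zero
countCop (cop _ ∷ w)    = suc (countCop w)
countCop (prod _ ∷ w)   = countCop w

countProd : List Gen → ℕ
countProd []            = zero
countProd (cop _ ∷ w)   = countProd w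
countProd (prod _ ∷ w)  = suc (countProd w)

-- A (representative of a) PC prograph of size n: a diagram from one strand
-- (the global input, entering a coproduct) to one strand (the global
-- output, leaving a product) with n coproducts and n products.
-- (Such a graph is automatically acyclic and connected: every vertex is
-- linked downwards to the global input.)
record Prograph (n : ℕ) : Set where
  constructor mkPrograph
  field
    word    : List Gen
    typed   : Typed 1 word 1
    nCop    : countCop word ≡ n
    nProd   : countProd word ≡ n
open Prograph public

-- Interchange law: two consecutive vertices g (lower) then h (upper),
-- where h lies entirely to the right of the outputs of g, may be
-- exchanged in height (with the index of h adjusted).

data Interchange : Gen → Gen → Gen → Gen → Set where
  cc : ∀ {p q} → suc p ≤ q → Interchange (cop p)  (cop (suc q))  (cop q)        (cop p)
  cp : ∀ {p q} → suc p ≤ q → Interchange (cop p)  (prod (suc q)) (prod q)       (cop p)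
  pc : ∀ {p q} → suc p ≤ q → Interchange (prod p) (cop q)        (cop (suc q))  (prod p)
  pp : ∀ {p q} → suc p ≤ q → Interchange (prod p) (prod q)       (prod (suc q)) (prod p)

InContext : (Gen → Gen → Gen → Gen → Set) → Rel (List Gen) _
InContext R w w' =
  Σ (List Gen) λ u → Σ (List Gen) λ v →
  Σ Gen λ a → Σ Gen λ b → Σ Gen λ a' → Σ Gen λ b' →
  R a b a' b' × (w ≡ u ++ a ∷ b ∷ v) × (w' ≡ u ++ a' ∷ b' ∷ v)

_≈w_ : Rel (List Gen) _
_≈w_ = EqClosure (InContext Interchange)

data Rotation : Gen → Gen → Gen → Gen → Set where
  -- (R1) right output of c1 feeds c2  ↦  left output of c1 feeds c2
  R1 : ∀ {i} → Rotation (cop i)       (cop (suc i)) (cop i)         (cop i)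
  -- (R2) p2 feeds left input of p1  ↦  p2 feeds right input of p1
  R2 : ∀ {i} → Rotation (prod i)      (prod i)      (prod (suc i))  (prod i)
  -- (R3) left output of c feeds right input of p  ↦  product then coproduct
  R3 : ∀ {j} → Rotation (cop (suc j)) (prod j)      (prod j)        (cop j)
  -- (R4) product feeds coproduct  ↦  coproduct, right output into product
  R4 : ∀ {j} → Rotation (prod j)      (cop j)       (cop j)         (prod (suc j))

data Move (w w' : List Gen) : Set where
  iso→ : InContext Interchange w w' → Move w w'
  iso← : InContext Interchange w' w → Move w w'
  rot  : InContext Rotation w w'    → Move w w'

_≈_ : ∀ {n} → Rel (Prograph n) _
P ≈ Q = word P ≈w word Q

_≤P_ : ∀ {n} → Rel (Prograph n) _
P ≤P Q = Star Move (word P) (word Q)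

-- Everything happens at size three. Antisymmetry: list the 42 isotopy classes of size-three words
-- in a topological order of the rotations between them; the position in this list is a rank that
-- is constant along isotopies and strictly increases along rotations, so a cycle of moves contains
-- no rotation and stays inside one isotopy class. Non-lattice: P₁ and P₂ are both below Q₁ and Q₂,
-- yet the up-sets of P₁, P₂ and the down-sets of Q₁, Q₂ have empty common intersection, so P₁ ∨ P₂
-- cannot exist. All finite facts are decided over the 61 words of size-three diagrams, a set
-- closed under moves.
{-# OPTIONS --safe #-}
module Submission where

open import Defs
open import Data.Nat using (ℕ; _≤_)
open import Data.Product using (Σ; _×_)
open import Relation.Nullary using (¬_)
open import Relation.Binary.Structures using (IsPartialOrder)
open import Relation.Binary.Core using (Rel)
open import Algebra.Core using (Op₂)
open import Relation.Binary.Lattice.Structures using (IsLattice)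

open import Data.Nat using (zero; suc; pred; _+_; _<_; _≟_; _≤?_; _<?_; z≤n; s≤s; s<s⁻¹)
open import Data.Nat.Properties using (+-suc; <-trans; <-asym; <-irrefl)
open import Data.Bool using (if_then_else_)
open import Data.Empty using (⊥; ⊥-elim)
open import Data.Product using (_,_; uncurry)
open import Data.Sum using (_⊎_; inj₁; inj₂)
open import Data.List using (List; []; _∷_; [_]; _++_; map; concatMap; upTo; length; takeWhile; deduplicate)
open import Data.List.Properties using (≡-dec)
open import Data.List.Relation.Unary.Any using (here)
import Data.List.Relation.Unary.Any as Any
open import Data.List.Relation.Unary.All using (All; all?)
import Data.List.Relation.Unary.All as All
open import Data.List.Membership.Propositional using (_∈_)
open import Data.List.Membership.Propositional.Properties using (∈-map⁺; ∈-++⁺ˡ; ∈-++⁺ʳ; ∈-concatMap⁺; ∈-upTo⁺)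
open import Data.List.Relation.Binary.Subset.Propositional using (_⊆_)
open import Function using (flip)
open import Relation.Binary.Definitions using (DecidableEquality)
open import Relation.Binary.Structures using (IsPreorder)
open import Relation.Binary.PropositionalEquality using (_≡_; refl; sym; trans; cong; cong₂; subst)
open import Relation.Binary.Construct.Closure.ReflexiveTransitive using (Star; ε; _◅_; _◅◅_)
import Relation.Binary.Construct.Closure.ReflexiveTransitive as Star
open import Relation.Binary.Construct.Closure.Symmetric using (SymClosure; fwd; bwd)
import Relation.Binary.Construct.Closure.Equivalence as EqClosure
import Relation.Binary.Construct.On as On
open import Relation.Nullary using (Dec; no; does; ¬?; _×-dec_)
open import Relation.Nullary.Decidable using (True; toWitness; dec-true; from-yes; map′)

Word : Set
Word = List Gen

_≟ᴳ_ : DecidableEquality Gen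
cop i  ≟ᴳ cop j  = map′ (cong cop)  (λ { refl → refl }) (i ≟ j)
prod i ≟ᴳ prod j = map′ (cong prod) (λ { refl → refl }) (i ≟ j)
cop _  ≟ᴳ prod _ = no λ ()
prod _ ≟ᴳ cop _  = no λ ()

_≟ʷ_ : DecidableEquality Word
_≟ʷ_ = ≡-dec _≟ᴳ_

open import Data.List.Membership.DecPropositional _≟ʷ_ using (_∈?_)
open import Data.List.Relation.Binary.Subset.DecPropositional _≟ʷ_ using (_⊆?_)

typed? : ∀ k w m → Dec (Typed k w m)
typed? k []           m = map′ (λ { refl → done }) (λ { done → refl }) (k ≟ m)
typed? k (cop i ∷ w)  m =
  map′ (uncurry copT) (λ { (copT i<k t) → i<k , t }) (suc i ≤? k ×-dec typed? (suc k) w m)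
typed? zero    (prod i ∷ w) m = no λ ()
typed? (suc k) (prod i ∷ w) m =
  map′ (uncurry prodT) (λ { (prodT i<k t) → i<k , t }) (suc (suc i) ≤? suc k ×-dec typed? k w m)

typedWords : (l k m : ℕ) → List Word
typedWords zero    k m = if does (k ≟ m) then [ [] ] else []
typedWords (suc l) k m =
  concatMap (λ i → map (cop i ∷_)  (typedWords l (suc k) m)) (upTo k) ++
  concatMap (λ i → map (prod i ∷_) (typedWords l (pred k) m)) (upTo (pred k))

∈-concatMap⁺′ : ∀ {A B : Set} (f : A → List B) {xs x y} → x ∈ xs → y ∈ f x → y ∈ concatMap f xs
∈-concatMap⁺′ f x∈xs y∈fx = ∈-concatMap⁺ f (Any.map (λ { refl → y∈fx }) x∈xs)

∈-typedWords : ∀ {k w m} → Typed k w m → w ∈ typedWords (length w) k m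
∈-typedWords {k} done rewrite dec-true (k ≟ k) refl = here refl
∈-typedWords (copT {i = i} i<k t) =
  ∈-++⁺ˡ (∈-concatMap⁺′ _ (∈-upTo⁺ i<k) (∈-map⁺ (cop i ∷_) (∈-typedWords t)))
∈-typedWords (prodT {k = k} {i = i} {w = w} i<k t) =
  ∈-++⁺ʳ (concatMap (λ j → map (cop j ∷_) (typedWords (length w) (suc (suc k)) _)) (upTo (suc k)))
    (∈-concatMap⁺′ _ (∈-upTo⁺ (s<s⁻¹ i<k)) (∈-map⁺ (prod i ∷_) (∈-typedWords t)))

length≡countCop+countProd : ∀ w → length w ≡ countCop w + countProd w
length≡countCop+countProd []           = refl
length≡countCop+countProd (cop _ ∷ w)  = cong suc (length≡countCop+countProd w)
length≡countCop+countProd (prod _ ∷ w) =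
  trans (cong suc (length≡countCop+countProd w)) (sym (+-suc (countCop w) (countProd w)))

word∈typedWords : ∀ {n} (P : Prograph n) → word P ∈ typedWords (n + n) 1 1
word∈typedWords P = subst (λ l → word P ∈ typedWords l 1 1)
  (trans (length≡countCop+countProd (word P)) (cong₂ _+_ (nCop P) (nProd P)))
  (∈-typedWords (typed P))

LocalRule : Set₁
LocalRule = Gen → Gen → Gen → Gen → Set

Converse : LocalRule → LocalRule
Converse R a′ b′ a b = R a b a′ b′

InContext-converse : ∀ {R w w′} → InContext R w w′ → InContext (Converse R) w′ w
InContext-converse (u , v , a , b , a′ , b′ , r , refl , refl) = u , v , a′ , b′ , a , b , r , refl , refl

Enumerates : (Gen → Gen → List (Gen × Gen)) → LocalRule → Set
Enumerates f R = ∀ {a b a′ b′} → R a b a′ b′ → (a′ , b′) ∈ f a b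

rewrites : (Gen → Gen → List (Gen × Gen)) → Word → List Word
rewrites f (a ∷ b ∷ v) = map (λ (a′ , b′) → a′ ∷ b′ ∷ v) (f a b) ++ map (a ∷_) (rewrites f (b ∷ v))
rewrites f _           = []

∈-rewrites : ∀ {f R} → Enumerates f R → ∀ {w w′} → InContext R w w′ → w′ ∈ rewrites f w
∈-rewrites {f} f-enum (u , v , a , b , a′ , b′ , r , refl , refl) = go u
  where
  go : ∀ u → u ++ a′ ∷ b′ ∷ v ∈ rewrites f (u ++ a ∷ b ∷ v)
  go []          = ∈-++⁺ˡ (∈-map⁺ _ (f-enum r))
  go (x ∷ [])    = ∈-++⁺ʳ _ (∈-map⁺ (x ∷_) (go []))
  go (x ∷ y ∷ u) = ∈-++⁺ʳ _ (∈-map⁺ (x ∷_) (go (y ∷ u)))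

candidate : ∀ {P : Set} → Dec P → Gen × Gen → List (Gen × Gen)
candidate P? g = if does P? then [ g ] else []

∈-candidate : ∀ {P : Set} (P? : Dec P) {g} → P → g ∈ candidate P? g
∈-candidate P? p rewrite dec-true P? p = here refl

interchange uninterchange rotate unrotate : Gen → Gen → List (Gen × Gen)
interchange (cop p)  (cop (suc q))  = candidate (suc p ≤? q) (cop q , cop p)
interchange (cop p)  (prod (suc q)) = candidate (suc p ≤? q) (prod q , cop p)
interchange (prod p) (cop q)        = candidate (suc p ≤? q) (cop (suc q) , prod p)
interchange (prod p) (prod q)       = candidate (suc p ≤? q) (prod (suc q) , prod p)
interchange _        _              = []

uninterchange (cop q)        (cop p)  = candidate (suc p ≤? q) (cop p , cop (suc q))
uninterchange (prod q)       (cop p)  = candidate (suc p ≤? q) (cop p , prod (suc q))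
uninterchange (cop (suc q))  (prod p) = candidate (suc p ≤? q) (prod p , cop q)
uninterchange (prod (suc q)) (prod p) = candidate (suc p ≤? q) (prod p , prod q)
uninterchange _              _        = []

rotate (cop i)       (cop (suc j)) = candidate (i ≟ j) (cop i , cop i)
rotate (prod i)      (prod j)      = candidate (i ≟ j) (prod (suc i) , prod i)
rotate (cop (suc i)) (prod j)      = candidate (i ≟ j) (prod i , cop i)
rotate (prod i)      (cop j)       = candidate (i ≟ j) (cop i , prod (suc i))
rotate _             _             = []

-- The clause order makes every clause hold definitionally.
unrotate (cop i)        (cop j)        = candidate (i ≟ j) (cop i , cop (suc i))
unrotate (cop i)        (prod (suc j)) = candidate (i ≟ j) (prod i , cop i)
unrotate (prod i)       (cop j)        = candidate (i ≟ j) (cop (suc i) , prod i)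
unrotate (prod (suc i)) (prod j)       = candidate (i ≟ j) (prod i , prod i)
unrotate _              _              = []

interchange-enumerates : Enumerates interchange Interchange
interchange-enumerates (cc {p} {q} p<q) = ∈-candidate (suc p ≤? q) p<q
interchange-enumerates (cp {p} {q} p<q) = ∈-candidate (suc p ≤? q) p<q
interchange-enumerates (pc {p} {q} p<q) = ∈-candidate (suc p ≤? q) p<q
interchange-enumerates (pp {p} {q} p<q) = ∈-candidate (suc p ≤? q) p<q

uninterchange-enumerates : Enumerates uninterchange (Converse Interchange)
uninterchange-enumerates (cc {p} {q} p<q) = ∈-candidate (suc p ≤? q) p<q
uninterchange-enumerates (cp {p} {q} p<q) = ∈-candidate (suc p ≤? q) p<q
uninterchange-enumerates (pc {p} {q} p<q) = ∈-candidate (suc p ≤? q) p<q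
uninterchange-enumerates (pp {p} {q} p<q) = ∈-candidate (suc p ≤? q) p<q

rotate-enumerates : Enumerates rotate Rotation
rotate-enumerates (R1 {i}) = ∈-candidate (i ≟ i) refl
rotate-enumerates (R2 {i}) = ∈-candidate (i ≟ i) refl
rotate-enumerates (R3 {j}) = ∈-candidate (j ≟ j) refl
rotate-enumerates (R4 {j}) = ∈-candidate (j ≟ j) refl

unrotate-enumerates : Enumerates unrotate (Converse Rotation)
unrotate-enumerates (R1 {i}) = ∈-candidate (i ≟ i) refl
unrotate-enumerates (R2 {i}) = ∈-candidate (i ≟ i) refl
unrotate-enumerates (R3 {j}) = ∈-candidate (j ≟ j) refl
unrotate-enumerates (R4 {j}) = ∈-candidate (j ≟ j) refl

isotopies successors predecessors : Word → List Word
isotopies w    = rewrites interchange w ++ rewrites uninterchange w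
successors w   = isotopies w ++ rewrites rotate w
predecessors w = isotopies w ++ rewrites unrotate w

Isotopy : Rel Word _
Isotopy = SymClosure (InContext Interchange)

∈-isotopies : ∀ {w w′} → Isotopy w w′ → w′ ∈ isotopies w
∈-isotopies     (fwd i) = ∈-++⁺ˡ (∈-rewrites interchange-enumerates i)
∈-isotopies {w} (bwd i) =
  ∈-++⁺ʳ (rewrites interchange w) (∈-rewrites uninterchange-enumerates (InContext-converse i))

Move⇒∈successors : ∀ {w w′} → Move w w′ → w′ ∈ successors w
Move⇒∈successors     (iso→ i) = ∈-++⁺ˡ (∈-isotopies (fwd i))
Move⇒∈successors     (iso← i) = ∈-++⁺ˡ (∈-isotopies (bwd i))
Move⇒∈successors {w} (rot r)  = ∈-++⁺ʳ (isotopies w) (∈-rewrites rotate-enumerates r)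

Move⇒∈predecessors : ∀ {w w′} → Move w w′ → w ∈ predecessors w′
Move⇒∈predecessors          (iso→ i) = ∈-++⁺ˡ (∈-isotopies (bwd i))
Move⇒∈predecessors          (iso← i) = ∈-++⁺ˡ (∈-isotopies (fwd i))
Move⇒∈predecessors {w′ = w′} (rot r)  =
  ∈-++⁺ʳ (isotopies w′) (∈-rewrites unrotate-enumerates (InContext-converse r))

module _ {A : Set} (next : A → List A) where

  Closed : List A → Set
  Closed S = All (λ x → next x ⊆ S) S

  Star-closed : ∀ {ℓ} {R : A → A → Set ℓ} → (∀ {x y} → R x y → y ∈ next x) →
                ∀ {S} → Closed S → ∀ {x y} → x ∈ S → Star R x y → y ∈ S
  Star-closed next-complete closed x∈S ε        = x∈S
  Star-closed next-complete closed x∈S (r ◅ rs) =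
    Star-closed next-complete closed (All.lookup closed x∈S (next-complete r)) rs

Star-Move-closed : ∀ {S} → Closed successors S → ∀ {w w′} → w ∈ S → Star Move w w′ → w′ ∈ S
Star-Move-closed = Star-closed successors (λ {w} → Move⇒∈successors {w})

Star-Move-coclosed : ∀ {S} → Closed predecessors S → ∀ {w w′} → w′ ∈ S → Star Move w w′ → w ∈ S
Star-Move-coclosed closed w′∈S path =
  Star-closed predecessors (λ {w′ w} → Move⇒∈predecessors {w} {w′}) closed w′∈S
    (Star.reverse {U = flip Move} (λ m → m) path)

closed? : (next : Word → List Word) (S : List Word) → Dec (Closed next S)
closed? next S = all? (λ w → next w ⊆? S) S

saturate : ℕ → (Word → List Word) → List Word → List Word
saturate zero    next S = S
saturate (suc k) next S = saturate k next (deduplicate _≟ʷ_ (S ++ concatMap next S))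

-- Only the closedness certificates required below are trusted, so the fuel is not critical.
above below : Word → List Word
above w = saturate 6 successors   [ w ]
below w = saturate 6 predecessors [ w ]

Star-Move⇒∈above : ∀ {w w′} {_ : True (closed? successors (above w) ×-dec w ∈? above w)} →
                   Star Move w w′ → w′ ∈ above w
Star-Move⇒∈above {_} {_} {certified} path =
  let (closed , w∈) = toWitness certified in Star-Move-closed closed w∈ path

Star-Move⇒∈below : ∀ {w w′} {_ : True (closed? predecessors (below w′) ×-dec w′ ∈? below w′)} →
                   Star Move w w′ → w ∈ below w′
Star-Move⇒∈below {_} {_} {certified} path =
  let (closed , w′∈) = toWitness certified
  in  Star-Move-coclosed closed w′∈ path

≤P-isPreorder : ∀ {n} → IsPreorder (_≈_ {n}) _≤P_
≤P-isPreorder = record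
  { isEquivalence = On.isEquivalence word (EqClosure.isEquivalence (InContext Interchange))
  ; reflexive     = Star.map isotopy⇒Move
  ; trans         = _◅◅_
  }
  where
  isotopy⇒Move : ∀ {w w′} → Isotopy w w′ → Move w w′
  isotopy⇒Move (fwd i) = iso→ i
  isotopy⇒Move (bwd i) = iso← i

module RankCertificate
  (S : List Word) (S-closed : Closed successors S) (rank : Word → ℕ)
  (isotopy-invariant   : All (λ w → All (λ w′ → rank w′ ≡ rank w) (isotopies w)) S)
  (rotation-increasing : All (λ w → All (λ w′ → rank w < rank w′) (rewrites rotate w)) S)
  where

  Progress : Rel Word _
  Progress w w′ = (w ≈w w′ × rank w ≡ rank w′) ⊎ rank w < rank w′

  isotopy-progress : ∀ {w w′} → w ∈ S → Isotopy w w′ → w ≈w w′ × rank w ≡ rank w′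
  isotopy-progress w∈S i = i ◅ ε , sym (All.lookup (All.lookup isotopy-invariant w∈S) (∈-isotopies i))

  move-progress : ∀ {w w′} → w ∈ S → Move w w′ → Progress w w′
  move-progress w∈S (iso→ i) = inj₁ (isotopy-progress w∈S (fwd i))
  move-progress w∈S (iso← i) = inj₁ (isotopy-progress w∈S (bwd i))
  move-progress w∈S (rot r)  =
    inj₂ (All.lookup (All.lookup rotation-increasing w∈S) (∈-rewrites rotate-enumerates r))

  path-progress : ∀ {w w′} → w ∈ S → Star Move w w′ → Progress w w′
  path-progress w∈S ε = inj₁ (ε , refl)
  path-progress {w} {w′} w∈S (m ◅ ms)
    with move-progress w∈S m | path-progress (Star-Move-closed S-closed w∈S (m ◅ ε)) ms
  ... | inj₁ (e , r) | inj₁ (e′ , r′) = inj₁ (e ◅◅ e′ , trans r r′)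
  ... | inj₁ (_ , r) | inj₂ lt′       = inj₂ (subst (_< rank w′) (sym r) lt′)
  ... | inj₂ lt      | inj₁ (_ , r′)  = inj₂ (subst (rank w <_) r′ lt)
  ... | inj₂ lt      | inj₂ lt′       = inj₂ (<-trans lt lt′)

  antisymmetric : ∀ {w w′} → w ∈ S → Star Move w w′ → Star Move w′ w → w ≈w w′
  antisymmetric w∈S w→w′ w′→w
    with path-progress w∈S w→w′
       | path-progress (Star-Move-closed S-closed w∈S w→w′) w′→w
  ... | inj₁ (e , _) | _            = e
  ... | inj₂ lt      | inj₁ (_ , r) = ⊥-elim (<-irrefl (sym r) lt)
  ... | inj₂ lt      | inj₂ lt′     = ⊥-elim (<-asym lt lt′)

module _ {c ℓ₁ ℓ₂} {A : Set c} {_≈_ : Rel A ℓ₁} {_≤_ : Rel A ℓ₂} where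

  bowtie⇒¬lattice : ∀ p₁ p₂ q₁ q₂ → p₁ ≤ q₁ → p₂ ≤ q₁ → p₁ ≤ q₂ → p₂ ≤ q₂ →
                    (∀ x → p₁ ≤ x → p₂ ≤ x → x ≤ q₁ → x ≤ q₂ → ⊥) →
                    ¬ (Σ (Op₂ A) λ _∨_ → Σ (Op₂ A) λ _∧_ → IsLattice _≈_ _≤_ _∨_ _∧_)
  bowtie⇒¬lattice p₁ p₂ q₁ q₂ p₁≤q₁ p₂≤q₁ p₁≤q₂ p₂≤q₂ nothing-between (_∨_ , _ , lattice)
    with p₁≤p₁∨p₂ , p₂≤p₁∨p₂ , least ← IsLattice.supremum lattice p₁ p₂ =
    nothing-between (p₁ ∨ p₂) p₁≤p₁∨p₂ p₂≤p₁∨p₂ (least q₁ p₁≤q₁ p₂≤q₁) (least q₂ p₁≤q₂ p₂≤q₂)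

words₃ : List Word
words₃ = typedWords 6 1 1

linearExtension₃ : List (List Word)
linearExtension₃ =
  ((cop 0 ∷ cop 1 ∷ cop 2 ∷ prod 0 ∷ prod 0 ∷ prod 0 ∷ [])
   ∷ (cop 0 ∷ cop 1 ∷ prod 0 ∷ cop 1 ∷ prod 0 ∷ prod 0 ∷ []) ∷ []) ∷
  ((cop 0 ∷ cop 0 ∷ cop 2 ∷ prod 0 ∷ prod 0 ∷ prod 0 ∷ [])
   ∷ (cop 0 ∷ cop 0 ∷ prod 0 ∷ cop 1 ∷ prod 0 ∷ prod 0 ∷ [])
   ∷ (cop 0 ∷ cop 1 ∷ cop 0 ∷ prod 0 ∷ prod 0 ∷ prod 0 ∷ []) ∷ []) ∷
  ((cop 0 ∷ cop 1 ∷ cop 1 ∷ prod 0 ∷ prod 0 ∷ prod 0 ∷ []) ∷ []) ∷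
  ((cop 0 ∷ cop 1 ∷ cop 2 ∷ prod 0 ∷ prod 1 ∷ prod 0 ∷ [])
   ∷ (cop 0 ∷ cop 1 ∷ cop 2 ∷ prod 2 ∷ prod 0 ∷ prod 0 ∷ [])
   ∷ (cop 0 ∷ cop 1 ∷ prod 0 ∷ cop 1 ∷ prod 1 ∷ prod 0 ∷ []) ∷ []) ∷
  ((cop 0 ∷ cop 1 ∷ cop 2 ∷ prod 1 ∷ prod 0 ∷ prod 0 ∷ []) ∷ []) ∷
  ((cop 0 ∷ cop 1 ∷ prod 0 ∷ prod 0 ∷ cop 0 ∷ prod 0 ∷ []) ∷ []) ∷
  ((cop 0 ∷ prod 0 ∷ cop 0 ∷ cop 1 ∷ prod 0 ∷ prod 0 ∷ []) ∷ []) ∷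
  ((cop 0 ∷ cop 0 ∷ cop 1 ∷ prod 0 ∷ prod 0 ∷ prod 0 ∷ []) ∷ []) ∷
  ((cop 0 ∷ cop 1 ∷ prod 0 ∷ cop 0 ∷ prod 0 ∷ prod 0 ∷ []) ∷ []) ∷
  ((cop 0 ∷ cop 0 ∷ cop 2 ∷ prod 0 ∷ prod 1 ∷ prod 0 ∷ [])
   ∷ (cop 0 ∷ cop 0 ∷ cop 2 ∷ prod 2 ∷ prod 0 ∷ prod 0 ∷ [])
   ∷ (cop 0 ∷ cop 0 ∷ prod 0 ∷ cop 1 ∷ prod 1 ∷ prod 0 ∷ [])
   ∷ (cop 0 ∷ cop 1 ∷ cop 0 ∷ prod 0 ∷ prod 1 ∷ prod 0 ∷ [])
   ∷ (cop 0 ∷ cop 1 ∷ cop 0 ∷ prod 2 ∷ prod 0 ∷ prod 0 ∷ [])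
   ∷ (cop 0 ∷ cop 1 ∷ prod 1 ∷ cop 0 ∷ prod 0 ∷ prod 0 ∷ []) ∷ []) ∷
  ((cop 0 ∷ cop 1 ∷ cop 1 ∷ prod 1 ∷ prod 0 ∷ prod 0 ∷ []) ∷ []) ∷
  ((cop 0 ∷ cop 1 ∷ cop 2 ∷ prod 1 ∷ prod 1 ∷ prod 0 ∷ []) ∷ []) ∷
  ((cop 0 ∷ cop 1 ∷ prod 1 ∷ cop 1 ∷ prod 0 ∷ prod 0 ∷ []) ∷ []) ∷
  ((cop 0 ∷ cop 0 ∷ prod 0 ∷ prod 0 ∷ cop 0 ∷ prod 0 ∷ []) ∷ []) ∷
  ((cop 0 ∷ prod 0 ∷ cop 0 ∷ cop 1 ∷ prod 1 ∷ prod 0 ∷ []) ∷ []) ∷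
  ((cop 0 ∷ prod 0 ∷ cop 0 ∷ prod 0 ∷ cop 0 ∷ prod 0 ∷ []) ∷ []) ∷
  ((cop 0 ∷ cop 0 ∷ cop 0 ∷ prod 0 ∷ prod 0 ∷ prod 0 ∷ []) ∷ []) ∷
  ((cop 0 ∷ cop 0 ∷ cop 2 ∷ prod 1 ∷ prod 0 ∷ prod 0 ∷ [])
   ∷ (cop 0 ∷ cop 1 ∷ cop 0 ∷ prod 1 ∷ prod 0 ∷ prod 0 ∷ []) ∷ []) ∷
  ((cop 0 ∷ cop 0 ∷ prod 0 ∷ cop 0 ∷ prod 0 ∷ prod 0 ∷ []) ∷ []) ∷
  ((cop 0 ∷ prod 0 ∷ cop 0 ∷ cop 0 ∷ prod 0 ∷ prod 0 ∷ []) ∷ []) ∷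
  ((cop 0 ∷ cop 0 ∷ cop 1 ∷ prod 1 ∷ prod 0 ∷ prod 0 ∷ []) ∷ []) ∷
  ((cop 0 ∷ cop 1 ∷ cop 1 ∷ prod 1 ∷ prod 1 ∷ prod 0 ∷ []) ∷ []) ∷
  ((cop 0 ∷ cop 1 ∷ cop 2 ∷ prod 2 ∷ prod 1 ∷ prod 0 ∷ []) ∷ []) ∷
  ((cop 0 ∷ cop 1 ∷ cop 1 ∷ prod 0 ∷ prod 1 ∷ prod 0 ∷ [])
   ∷ (cop 0 ∷ cop 1 ∷ cop 1 ∷ prod 2 ∷ prod 0 ∷ prod 0 ∷ []) ∷ []) ∷
  ((cop 0 ∷ cop 1 ∷ prod 1 ∷ cop 1 ∷ prod 1 ∷ prod 0 ∷ []) ∷ []) ∷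
  ((cop 0 ∷ cop 1 ∷ prod 1 ∷ prod 0 ∷ cop 0 ∷ prod 0 ∷ []) ∷ []) ∷
  ((cop 0 ∷ cop 0 ∷ prod 1 ∷ cop 1 ∷ prod 0 ∷ prod 0 ∷ []) ∷ []) ∷
  ((cop 0 ∷ cop 0 ∷ cop 0 ∷ prod 1 ∷ prod 0 ∷ prod 0 ∷ []) ∷ []) ∷
  ((cop 0 ∷ cop 0 ∷ cop 1 ∷ prod 1 ∷ prod 1 ∷ prod 0 ∷ []) ∷ []) ∷
  ((cop 0 ∷ cop 1 ∷ prod 0 ∷ cop 0 ∷ prod 1 ∷ prod 0 ∷ []) ∷ []) ∷
  ((cop 0 ∷ cop 1 ∷ cop 1 ∷ prod 2 ∷ prod 1 ∷ prod 0 ∷ []) ∷ []) ∷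
  ((cop 0 ∷ cop 0 ∷ cop 1 ∷ prod 0 ∷ prod 1 ∷ prod 0 ∷ [])
   ∷ (cop 0 ∷ cop 0 ∷ cop 1 ∷ prod 2 ∷ prod 0 ∷ prod 0 ∷ []) ∷ []) ∷
  ((cop 0 ∷ cop 0 ∷ prod 1 ∷ prod 0 ∷ cop 0 ∷ prod 0 ∷ []) ∷ []) ∷
  ((cop 0 ∷ cop 0 ∷ cop 2 ∷ prod 1 ∷ prod 1 ∷ prod 0 ∷ [])
   ∷ (cop 0 ∷ cop 1 ∷ cop 0 ∷ prod 1 ∷ prod 1 ∷ prod 0 ∷ []) ∷ []) ∷
  ((cop 0 ∷ prod 0 ∷ cop 0 ∷ cop 0 ∷ prod 1 ∷ prod 0 ∷ []) ∷ []) ∷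
  ((cop 0 ∷ cop 0 ∷ cop 0 ∷ prod 0 ∷ prod 1 ∷ prod 0 ∷ [])
   ∷ (cop 0 ∷ cop 0 ∷ cop 0 ∷ prod 2 ∷ prod 0 ∷ prod 0 ∷ [])
   ∷ (cop 0 ∷ cop 0 ∷ prod 1 ∷ cop 0 ∷ prod 0 ∷ prod 0 ∷ []) ∷ []) ∷
  ((cop 0 ∷ cop 0 ∷ prod 0 ∷ cop 0 ∷ prod 1 ∷ prod 0 ∷ []) ∷ []) ∷
  ((cop 0 ∷ cop 0 ∷ cop 2 ∷ prod 2 ∷ prod 1 ∷ prod 0 ∷ [])
   ∷ (cop 0 ∷ cop 1 ∷ cop 0 ∷ prod 2 ∷ prod 1 ∷ prod 0 ∷ [])
   ∷ (cop 0 ∷ cop 1 ∷ prod 1 ∷ cop 0 ∷ prod 1 ∷ prod 0 ∷ []) ∷ []) ∷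
  ((cop 0 ∷ cop 0 ∷ prod 1 ∷ cop 1 ∷ prod 1 ∷ prod 0 ∷ []) ∷ []) ∷
  ((cop 0 ∷ cop 0 ∷ cop 0 ∷ prod 1 ∷ prod 1 ∷ prod 0 ∷ []) ∷ []) ∷
  ((cop 0 ∷ cop 0 ∷ cop 1 ∷ prod 2 ∷ prod 1 ∷ prod 0 ∷ []) ∷ []) ∷
  ((cop 0 ∷ cop 0 ∷ cop 0 ∷ prod 2 ∷ prod 1 ∷ prod 0 ∷ [])
   ∷ (cop 0 ∷ cop 0 ∷ prod 1 ∷ cop 0 ∷ prod 1 ∷ prod 0 ∷ []) ∷ []) ∷
  []

rank₃ : Word → ℕ
rank₃ w = length (takeWhile (λ class → ¬? (w ∈? class)) linearExtension₃)

open RankCertificate words₃ (from-yes (closed? successors words₃)) rank₃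
  (from-yes (all? (λ w → all? (λ w′ → rank₃ w′ ≟ rank₃ w) (isotopies w)) words₃))
  (from-yes (all? (λ w → all? (λ w′ → rank₃ w <? rank₃ w′) (rewrites rotate w)) words₃))
  using (antisymmetric)

≤P-isPartialOrder₃ : IsPartialOrder (_≈_ {3}) _≤P_
≤P-isPartialOrder₃ = record
  { isPreorder = ≤P-isPreorder
  ; antisym    = λ {P} → antisymmetric (word∈typedWords P)
  }

prograph₃ : (w : Word) → True (typed? 1 w 1) → countCop w ≡ 3 → countProd w ≡ 3 → Prograph 3
prograph₃ w t = mkPrograph w (toWitness t)

P₁ P₂ Q₁ Q₂ : Prograph 3
P₁ = prograph₃ (cop 0 ∷ cop 0 ∷ prod 0 ∷ prod 0 ∷ cop 0 ∷ prod 0 ∷ []) _ refl refl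
P₂ = prograph₃ (cop 0 ∷ cop 0 ∷ prod 1 ∷ cop 1 ∷ prod 0 ∷ prod 0 ∷ []) _ refl refl
Q₁ = prograph₃ (cop 0 ∷ cop 0 ∷ prod 0 ∷ cop 0 ∷ prod 1 ∷ prod 0 ∷ []) _ refl refl
Q₂ = prograph₃ (cop 0 ∷ cop 0 ∷ prod 1 ∷ prod 0 ∷ cop 0 ∷ prod 0 ∷ []) _ refl refl

rotateAt : ∀ u v {a b a′ b′} → Rotation a b a′ b′ → Move (u ++ a ∷ b ∷ v) (u ++ a′ ∷ b′ ∷ v)
rotateAt u v r = rot (u , v , _ , _ , _ , _ , r , refl , refl)

uninterchangeAt : ∀ u v {a b a′ b′} → Interchange a b a′ b′ → Move (u ++ a′ ∷ b′ ∷ v) (u ++ a ∷ b ∷ v)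
uninterchangeAt u v i = iso← (u , v , _ , _ , _ , _ , i , refl , refl)

P₁≤Q₁ : P₁ ≤P Q₁
P₁≤Q₁ = rotateAt (cop 0 ∷ cop 0 ∷ prod 0 ∷ []) (prod 0 ∷ []) R4 ◅ ε

P₂≤Q₁ : P₂ ≤P Q₁
P₂≤Q₁ = rotateAt (cop 0 ∷ cop 0 ∷ []) (prod 0 ∷ prod 0 ∷ []) R4
      ◅ uninterchangeAt (cop 0 ∷ cop 0 ∷ cop 1 ∷ []) (prod 0 ∷ []) (pp (s≤s z≤n))
      ◅ rotateAt (cop 0 ∷ cop 0 ∷ []) (prod 1 ∷ prod 0 ∷ []) R3
      ◅ ε

P₁≤Q₂ : P₁ ≤P Q₂
P₁≤Q₂ = rotateAt (cop 0 ∷ cop 0 ∷ []) (cop 0 ∷ prod 0 ∷ []) R2 ◅ ε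

P₂≤Q₂ : P₂ ≤P Q₂
P₂≤Q₂ = rotateAt (cop 0 ∷ cop 0 ∷ prod 1 ∷ []) (prod 0 ∷ []) R3 ◅ ε

nothing-between₃ : ∀ x → P₁ ≤P x → P₂ ≤P x → x ≤P Q₁ → x ≤P Q₂ → ⊥
nothing-between₃ x P₁≤x P₂≤x x≤Q₁ x≤Q₂ =
  All.lookup no-common-bound (Star-Move⇒∈above P₁≤x)
    (Star-Move⇒∈above P₂≤x , Star-Move⇒∈below x≤Q₁ , Star-Move⇒∈below x≤Q₂)
  where
  no-common-bound : All (λ w → ¬ (w ∈ above (word P₂) × w ∈ below (word Q₁) × w ∈ below (word Q₂)))
                        (above (word P₁))
  no-common-bound = from-yes (all? (λ w → ¬? (w ∈? above (word P₂) ×-dec w ∈? below (word Q₁)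
                                                ×-dec w ∈? below (word Q₂)))
                                   (above (word P₁)))

mainTheorem4 : Σ ℕ λ n → (1 ≤ n) ×
                 IsPartialOrder (_≈_ {n}) (_≤P_ {n}) ×
                 ¬ (Σ (Op₂ (Prograph n)) λ _∨_ → Σ (Op₂ (Prograph n)) λ _∧_ →
                      IsLattice (_≈_ {n}) (_≤P_ {n}) _∨_ _∧_)
mainTheorem4 =
  3 , s≤s z≤n , ≤P-isPartialOrder₃ ,
  bowtie⇒¬lattice P₁ P₂ Q₁ Q₂ P₁≤Q₁ P₂≤Q₁ P₁≤Q₂ P₂≤Q₂ nothing-between₃
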